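{- Let $G$ be a graph and let $k\in\mathbb{N}$ be odd. Suppose that the complement $G^c$ is a $k$-regular graph with girth at least $5$ that does not contain a perfect matching. Then $\mathrm{lbox}(G)\ge\tfrac{k+3}{2}$.
   Context: All graphs are finite and simple. The girth of a graph is the length of a shortest cycle (infinite if acyclic). A real interval is either a bounded interval of $\mathbb{R}$ or $\mathbb{R}$ itself. For an integer $d'\ge 1$, a $d'$-box is a Cartesian product $I_1\times\cdots\times I_{d'}$ of real intervals; it is local in dimension $i$ if $I_i$ is bounded. A $d$-local box in dimension $d'\ge d$ is a $d'$-box that is local in at most $d$ dimensions. The local boxicity $\mathrm{lbox}(G)$ of a graph $G$ is the minimum integer $d$ such that, for some $d'$, there are $d$-local boxes $(B_v)_{v\in V(G)}$ in dimension $d'$ such that two distinct vertices $u,v$ are adjacent in $G$ if and only if $B_u\cap B_v\neq\emptyset$. -}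

module Defs where

open import Level using (0ℓ)
open import Data.Nat using (ℕ; zero; suc; _+_; _*_; _≤_)
open import Data.Bool using (Bool; true; false; not; if_then_else_)
open import Data.Fin using (Fin; toℕ) renaming (zero to fzero; suc to fsuc)
open import Data.List using (List; map; allFin)
open import Data.Nat.ListAction using (sum)
open import Data.Product using (Σ; ∃; _×_; _,_)
open import Relation.Nullary using (¬_; does)
open import Relation.Binary.PropositionalEquality using (_≡_)
open import Relation.Binary.Structures using (IsStrictTotalOrder)
open import Algebra.Structures using (IsCommutativeRing)
import Data.Fin as Fin

-- The real numbers, given axiomatically as a Dedekind-complete ordered
-- field (unique up to isomorphism).  The theorem quantifies over any
-- such structure.

record Reals : Set₁ where
  infixl 6 _+ℝ_
  infixl 7 _*ℝ_
  infix 4 _<ℝ_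
  field
    ℝ : Set
    _<ℝ_ : ℝ → ℝ → Set
    _+ℝ_ _*ℝ_ : ℝ → ℝ → ℝ
    -ℝ_ : ℝ → ℝ
    0ℝ 1ℝ : ℝ
    isStrictTotalOrder : IsStrictTotalOrder _≡_ _<ℝ_
    isCommutativeRing : IsCommutativeRing _≡_ _+ℝ_ _*ℝ_ -ℝ_ 0ℝ 1ℝ
    0≢1 : ¬ (0ℝ ≡ 1ℝ)
    inverse : ∀ x → ¬ (x ≡ 0ℝ) → ∃ λ y → x *ℝ y ≡ 1ℝ
    +-mono-< : ∀ x y z → x <ℝ y → x +ℝ z <ℝ y +ℝ z
    *-pos : ∀ x y → 0ℝ <ℝ x → 0ℝ <ℝ y → 0ℝ <ℝ x *ℝ y
    complete : (P : ℝ → Set) → (∃ λ x → P x) →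
               (∃ λ b → ∀ x → P x → ¬ (b <ℝ x)) →
               ∃ λ s → (∀ x → P x → ¬ (s <ℝ x)) ×
                       (∀ b → (∀ x → P x → ¬ (b <ℝ x)) → ¬ (b <ℝ s))

record Graph (n : ℕ) : Set where
  field
    adj   : Fin n → Fin n → Bool
    sym   : ∀ u v → adj u v ≡ adj v u
    irrefl : ∀ v → adj v v ≡ false
open Graph public

complement : ∀ {n} → Graph n → Graph n
complement {n} G = record { adj = cadj ; sym = csym ; irrefl = cirr }
  where
  open import Data.Fin.Properties using (_≟_)
  open import Relation.Binary.PropositionalEquality using (refl; sym; cong)
  open import Relation.Nullary using (yes; no)
  cadj : Fin n → Fin n → Bool
  cadj u v with u ≟ v
  ... | yes _ = false
  ... | no _  = not (adj G u v)
  csym : ∀ u v → cadj u v ≡ cadj v u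
  csym u v with u ≟ v | v ≟ u
  ... | yes _ | yes _ = refl
  ... | yes p | no q = Data.Empty.⊥-elim (q (Relation.Binary.PropositionalEquality.sym p))
    where import Data.Empty
  ... | no p | yes q = Data.Empty.⊥-elim (p (Relation.Binary.PropositionalEquality.sym q))
    where import Data.Empty
  ... | no _ | no _ = cong not (Graph.sym G u v)
  cirr : ∀ v → cadj v v ≡ false
  cirr v with v ≟ v
  ... | yes _ = refl
  ... | no p = Data.Empty.⊥-elim (p refl)
    where import Data.Empty

countTrue : ∀ {n} → (Fin n → Bool) → ℕ
countTrue {n} f = sum (map (λ u → if f u then 1 else 0) (allFin n))

degree : ∀ {n} → Graph n → Fin n → ℕ
degree G v = countTrue (adj G v)

Regular : ∀ {n} → ℕ → Graph n → Set
Regular k G = ∀ v → degree G v ≡ k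

record Cycle {n : ℕ} (G : Graph n) (len : ℕ) : Set where
  field
    m       : ℕ
    len≡    : len ≡ suc m
    len≥3   : 3 ≤ len
    walk    : Fin (suc m) → Fin n
    inj     : ∀ i j → walk i ≡ walk j → i ≡ j
    step    : ∀ (i : Fin m) → adj G (walk (Fin.inject₁ i)) (walk (fsuc i)) ≡ true
    close   : adj G (walk (Fin.fromℕ m)) (walk fzero) ≡ true

GirthAtLeast : ∀ {n} → ℕ → Graph n → Set
GirthAtLeast g G = ∀ len → Cycle G len → g ≤ len

record PerfectMatching {n : ℕ} (G : Graph n) : Set where
  field
    M      : Fin n → Fin n → Bool
    M-sym  : ∀ u v → M u v ≡ M v u
    M⊆E    : ∀ u v → M u v ≡ true → adj G u v ≡ true
    cover1 : ∀ v → countTrue (M v) ≡ 1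

module _ (R : Reals) where
  open Reals R

  -- A real interval: a bounded interval with endpoints a , b, each
  -- open or closed (flag true = closed; this includes empty and
  -- degenerate intervals), or the whole real line.
  data Interval : Set where
    bounded : (a : ℝ) (aClosed : Bool) (b : ℝ) (bClosed : Bool) → Interval
    whole   : Interval

  _≤ℝ_ : ℝ → ℝ → Set
  x ≤ℝ y = ¬ (y <ℝ x)

  lowerOK : Bool → ℝ → ℝ → Set
  lowerOK true  a x = a ≤ℝ x
  lowerOK false a x = a <ℝ x

  upperOK : Bool → ℝ → ℝ → Set
  upperOK true  b x = x ≤ℝ b
  upperOK false b x = x <ℝ b

  _∈I_ : ℝ → Interval → Set
  x ∈I bounded a ca b cb = lowerOK ca a x × upperOK cb b x
  x ∈I whole = Data.Unit.⊤
    where import Data.Unit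

  isBounded : Interval → Bool
  isBounded (bounded _ _ _ _) = true
  isBounded whole = false

  Box : ℕ → Set
  Box d' = Fin d' → Interval

  localDims : ∀ {d'} → Box d' → ℕ
  localDims B = countTrue (λ i → isBounded (B i))

  BoxesMeet : ∀ {d'} → Box d' → Box d' → Set
  BoxesMeet {d'} B C = ∃ λ (p : Fin d' → ℝ) → ∀ i → (p i ∈I B i) × (p i ∈I C i)

  HasLocalBoxRep : ∀ {n} → Graph n → ℕ → Set
  HasLocalBoxRep {n} G d =
    Σ ℕ λ d' → d ≤ d' × Σ (Fin n → Box d') λ B →
      (∀ v → localDims (B v) ≤ d) ×
      (∀ u v → ¬ (u ≡ v) → (adj G u v ≡ true → BoxesMeet (B u) (B v))
                          × (BoxesMeet (B u) (B v) → adj G u v ≡ true))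

  -- lbox(G) ≥ x, with x = q/2 given as a half-integer:
  -- every d admitting a d-local box representation satisfies q ≤ 2d
  LboxAtLeastHalf : ∀ {n} → Graph n → ℕ → Set
  LboxAtLeastHalf G q = ∀ d → HasLocalBoxRep G d → q ≤ 2 * d

-- Write H for the complement of G and k = 2j + 1, and suppose G has a d-local box
-- representation with 2d < k + 3, that is d ≤ j + 1.  Every edge uv of H is witnessed by a
-- dimension in which the intervals of u and v are disjoint, hence comparable (one lies to the
-- left of the other), and then both intervals are bounded.  In each dimension comparability is
-- an interval order whose comparability graph lies in H; as H has no triangles and no 4-cycles,
-- two vertices each comparable to two others are comparable to each other.  Call a dimension
-- heavy for v when v is comparable to at least two vertices in it.  Each light local dimension
-- accounts for at most one neighbour of v, so v has at least k − (d − A v) ≥ j + A v neighbours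
-- separated from it only in its A v heavy dimensions, and at most A v of these neighbours are
-- in the same relation to v.  Double counting forces A v = 1 and exactly one such mutual
-- neighbour for every v, a perfect matching of H.  An empty interval would make a vertex
-- adjacent in H to all others, which a triangle-free k-regular graph with k ≥ 3 forbids; for
-- k = 1, H itself is a perfect matching.

module Submission where

open import Defs hiding (sym)
open import Function using (_∘_; flip)
open import Data.Nat using (ℕ; zero; suc; _+_; _*_; _≤_; _<_; _<ᵇ_; z≤n; s≤s; _≤?_)
open import Data.Nat.Properties
open import Data.Nat.Tactic.RingSolver using (solve-∀)
open import Data.Bool using (Bool; true; false; not; _∧_; if_then_else_; T)
open import Data.Fin using (Fin; inject₁; fromℕ) renaming (zero to fzero; suc to fsuc)
open import Data.Vec using (Vec; []; _∷_; lookup)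
open import Data.Vec.Relation.Unary.All using ([]; _∷_)
open import Data.Vec.Relation.Unary.AllPairs using ([]; _∷_)
open import Data.Vec.Relation.Unary.Unique.Propositional using (Unique)
open import Data.Vec.Relation.Unary.Unique.Propositional.Properties using (lookup-injective)
import Data.Fin.Properties as Fin
import Data.Bool.Properties as Bool
open import Data.Bool.Properties using (∧-conicalˡ; ∧-conicalʳ; ∧-comm; ∧-zeroʳ; ¬-not; not-injective)
import Data.List.Base as List using (tabulate)
import Data.List.Properties as List using (map-tabulate)
import Data.Nat.ListAction as List using (sum)
open import Data.Product using (∃; ∃₂; _×_; _,_; proj₁; proj₂)
open import Data.Sum using (_⊎_; inj₁; inj₂; swap)
open import Data.Empty using (⊥; ⊥-elim)
open import Data.Unit using (tt)
open import Relation.Nullary using (¬_; Dec; yes; no; does)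
open import Relation.Nullary.Decidable using (dec-true; decidable-stable; ¬¬-excluded-middle)
open import Relation.Binary.Structures using (IsStrictTotalOrder)
open import Relation.Binary.Definitions using (tri<; tri≈; tri>)
open import Relation.Binary.PropositionalEquality
open import Algebra.Properties.CommutativeMonoid.Sum +-0-commutativeMonoid
  using (sum; ∑-distrib-+; ∑-comm; sum-cong-≗)

-- Counting over finite index sets

indicator : Bool → ℕ
indicator b = if b then 1 else 0

count : ∀ {n} → (Fin n → Bool) → ℕ
count f = sum (indicator ∘ f)

countTrue≡count : ∀ {n} (f : Fin n → Bool) → countTrue f ≡ count f
countTrue≡count f =
  trans (cong List.sum (List.map-tabulate (λ x → x) (indicator ∘ f))) (sum-tabulate (indicator ∘ f))
  where
  sum-tabulate : ∀ {m} (g : Fin m → ℕ) → List.sum (List.tabulate g) ≡ sum g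
  sum-tabulate {zero}  g = refl
  sum-tabulate {suc m} g = cong (g fzero +_) (sum-tabulate (g ∘ fsuc))

sum-mono-≤ : ∀ {n} {f g : Fin n → ℕ} → (∀ x → f x ≤ g x) → sum f ≤ sum g
sum-mono-≤ {zero}  f≤g = z≤n
sum-mono-≤ {suc n} f≤g = +-mono-≤ (f≤g fzero) (sum-mono-≤ (f≤g ∘ fsuc))

single≤sum : ∀ {n} (f : Fin n → ℕ) x → f x ≤ sum f
single≤sum f fzero    = m≤m+n _ _
single≤sum f (fsuc x) = ≤-trans (single≤sum (f ∘ fsuc) x) (m≤n+m _ _)

sum-squeeze : ∀ {n} {f g : Fin n → ℕ} → (∀ x → g x ≤ f x) → sum f ≤ sum g → ∀ x → f x ≡ g x
sum-squeeze {suc n} {f} {g} g≤f ∑f≤∑g = λ where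
    fzero    → ≤-antisym head≤ (g≤f fzero)
    (fsuc x) → sum-squeeze (g≤f ∘ fsuc) tail≤ x
  where
  head≤ : f fzero ≤ g fzero
  head≤ = +-cancelʳ-≤ (sum (f ∘ fsuc)) _ _
    (≤-trans ∑f≤∑g (+-monoʳ-≤ (g fzero) (sum-mono-≤ (g≤f ∘ fsuc))))
  tail≤ : sum (f ∘ fsuc) ≤ sum (g ∘ fsuc)
  tail≤ = +-cancelˡ-≤ (f fzero) _ _
    (≤-trans ∑f≤∑g (+-monoˡ-≤ (sum (g ∘ fsuc)) (g≤f fzero)))

none⇒count≡0 : ∀ {n} (f : Fin n → Bool) → (∀ x → f x ≡ false) → count f ≡ 0
none⇒count≡0 {zero}  f none = refl
none⇒count≡0 {suc n} f none rewrite none fzero = none⇒count≡0 (f ∘ fsuc) (none ∘ fsuc)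

witness⇒1≤count : ∀ {n} (f : Fin n → Bool) {x} → f x ≡ true → 1 ≤ count f
witness⇒1≤count f {x} fx = subst (λ b → indicator b ≤ count f) fx (single≤sum (indicator ∘ f) x)

1≤count⇒∃ : ∀ {n} (f : Fin n → Bool) → 1 ≤ count f → ∃ λ x → f x ≡ true
1≤count⇒∃ {suc n} f pos with f fzero in f0
... | true  = fzero , f0
... | false = let x , fx = 1≤count⇒∃ (f ∘ fsuc) pos in fsuc x , fx

2≤count⇒∃₂ : ∀ {n} (f : Fin n → Bool) → 2 ≤ count f →
              ∃₂ λ x y → x ≢ y × f x ≡ true × f y ≡ true
2≤count⇒∃₂ {suc n} f two with f fzero in f0
... | true  = let y , fy = 1≤count⇒∃ (f ∘ fsuc) (≤-pred two) in fzero , fsuc y , (λ ()) , f0 , fy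
... | false = let x , y , x≢y , fx , fy = 2≤count⇒∃₂ (f ∘ fsuc) two
              in fsuc x , fsuc y , x≢y ∘ Fin.suc-injective , fx , fy

unique⇒count≤1 : ∀ {n} (f : Fin n → Bool) → (∀ x y → f x ≡ true → f y ≡ true → x ≡ y) →
                 count f ≤ 1
unique⇒count≤1 f unique = ≮⇒≥ λ 1<count →
  let x , y , x≢y , fx , fy = 2≤count⇒∃₂ f 1<count in x≢y (unique x y fx fy)

count-≤-split : ∀ {n} (f g : Fin n → Bool) → count f ≤ count g + count (λ x → f x ∧ not (g x))
count-≤-split f g = ≤-trans (sum-mono-≤ (λ x → pointwise (f x) (g x)))
                            (≤-reflexive (∑-distrib-+ (indicator ∘ g) _))
  where
  pointwise : ∀ a b → indicator a ≤ indicator b + indicator (a ∧ not b)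
  pointwise true  true  = s≤s z≤n
  pointwise true  false = s≤s z≤n
  pointwise false _     = z≤n

cover⇒count≤∑count : ∀ {m n} (f : Fin n → Bool) (g : Fin m → Fin n → Bool) →
                     (∀ x → f x ≡ true → ∃ λ i → g i x ≡ true) →
                     count f ≤ sum (λ i → count (g i))
cover⇒count≤∑count f g cover =
  ≤-trans (sum-mono-≤ pointwise) (≤-reflexive (∑-comm (λ x i → indicator (g i x))))
  where
  pointwise : ∀ x → indicator (f x) ≤ count (λ i → g i x)
  pointwise x with f x in fx
  ... | true  = witness⇒1≤count (λ i → g i x) (proj₂ (cover x fx))
  ... | false = z≤n

∑-+-transpose : ∀ {n} (f : Fin n → Fin n → ℕ) →
                sum (λ v → sum (f v) + sum (f v)) ≡ sum (λ v → sum (λ u → f v u + f u v))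
∑-+-transpose f = begin
  sum (λ v → sum (f v) + sum (f v))                 ≡⟨ ∑-distrib-+ (sum ∘ f) (sum ∘ f) ⟩
  sum (λ v → sum (f v)) + sum (λ v → sum (f v))     ≡⟨ cong (sum (λ v → sum (f v)) +_) (∑-comm f) ⟩
  sum (λ v → sum (f v)) + sum (λ v → sum (flip f v)) ≡⟨ ∑-distrib-+ (sum ∘ f) (sum ∘ flip f) ⟨
  sum (λ v → sum (f v) + sum (flip f v))            ≡⟨ sum-cong-≗ (λ v → ∑-distrib-+ (f v) (flip f v)) ⟨
  sum (λ v → sum (λ u → f v u + f u v))             ∎
  where open ≡-Reasoning

any : ∀ {n} → (Fin n → Bool) → Bool
any f = does (Fin.any? λ x → f x Bool.≟ true)

any⇒∃ : ∀ {n} {f : Fin n → Bool} → any f ≡ true → ∃ λ x → f x ≡ true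
any⇒∃ {f = f} some with Fin.any? (λ x → f x Bool.≟ true)
... | yes witness = witness

¬any⇒∀ : ∀ {n} {f : Fin n → Bool} → any f ≡ false → ∀ x → f x ≡ false
¬any⇒∀ {f = f} none x with Fin.any? (λ x → f x Bool.≟ true)
... | no ¬witness = ¬-not λ fx → ¬witness (x , fx)

true≢false : true ≢ false
true≢false ()

∧-intro : ∀ {a b} → a ≡ true → b ≡ true → a ∧ b ≡ true
∧-intro refl refl = refl

indicator-∧-pair : ∀ a b c → indicator (a ∧ b) + indicator (a ∧ c) ≤
                             indicator a + indicator ((a ∧ b) ∧ (a ∧ c))
indicator-∧-pair false _     _     = z≤n
indicator-∧-pair true  true  true  = ≤-refl
indicator-∧-pair true  true  false = ≤-refl
indicator-∧-pair true  false true  = ≤-refl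
indicator-∧-pair true  false false = z≤n

odd≤l+h⇒j+a≤h : ∀ j a l h → suc (j + j) ≤ l + h → a + l ≤ suc j → j + a ≤ h
odd≤l+h⇒j+a≤h j a l h k≤l+h a+l≤d = +-cancelˡ-≤ (suc j) (j + a) h (begin
  suc j + (j + a)  ≡⟨ shift j a ⟩
  suc (j + j) + a  ≤⟨ +-monoˡ-≤ a k≤l+h ⟩
  l + h + a        ≡⟨ rearrange l h a ⟩
  h + (a + l)      ≤⟨ +-monoʳ-≤ h a+l≤d ⟩
  h + suc j        ≡⟨ +-comm h (suc j) ⟩
  suc j + h        ∎)
  where
  open ≤-Reasoning
  shift : ∀ j a → suc j + (j + a) ≡ suc (j + j) + a
  shift = solve-∀
  rearrange : ∀ l h a → l + h + a ≡ h + (a + l)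
  rearrange = solve-∀

private
  double-+ : ∀ j a → (j + a) + (j + a) ≡ (j + j) + (a + a)
  double-+ = solve-∀

  odd-+ : ∀ j m → suc (j + j) + m ≡ (j + j) + suc m
  odd-+ = solve-∀

odd+m≤double : ∀ j a m → m ≤ a → 1 ≤ a → suc (j + j) + m ≤ (j + a) + (j + a)
odd+m≤double j a m m≤a 1≤a = begin
  suc (j + j) + m    ≡⟨ odd-+ j m ⟩
  (j + j) + suc m    ≤⟨ +-monoʳ-≤ (j + j) (+-mono-≤ 1≤a m≤a) ⟩
  (j + j) + (a + a)  ≡⟨ double-+ j a ⟨
  (j + a) + (j + a)  ∎
  where open ≤-Reasoning

odd+m≡double⇒m≡1 : ∀ j a m → m ≤ a → (j + a) + (j + a) ≡ suc (j + j) + m → m ≡ 1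
odd+m≡double⇒m≡1 j a m m≤a eq = a≤1⇒m≡1 a≤1 a+a≡1+m
  where
  a+a≡1+m : a + a ≡ suc m
  a+a≡1+m = +-cancelˡ-≡ (j + j) (a + a) (suc m) (trans (sym (double-+ j a)) (trans eq (odd-+ j m)))
  a≤1 : a ≤ 1
  a≤1 = +-cancelʳ-≤ a a 1 (subst (_≤ suc a) (sym a+a≡1+m) (s≤s m≤a))
  a≤1⇒m≡1 : ∀ {a} → a ≤ 1 → a + a ≡ suc m → m ≡ 1
  a≤1⇒m≡1 (s≤s z≤n) 2≡1+m = sym (suc-injective 2≡1+m)

-- Graphs of girth at least five

TriangleFree : ∀ {n} → Graph n → Set
TriangleFree H = ∀ a b c → adj H a b ≡ true → adj H b c ≡ true → adj H c a ≡ true → ⊥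

SquareFree : ∀ {n} → Graph n → Set
SquareFree H = ∀ a b c d → a ≢ c → b ≢ d →
  adj H a b ≡ true → adj H b c ≡ true → adj H c d ≡ true → adj H d a ≡ true → ⊥

module _ {n : ℕ} (H : Graph n) where

  adj⇒≢ : ∀ {u v} → adj H u v ≡ true → u ≢ v
  adj⇒≢ {u} uv refl with () ← trans (sym uv) (irrefl H u)

  adj-sym : ∀ {u v} → adj H u v ≡ true → adj H v u ≡ true
  adj-sym {u} {v} uv = trans (Graph.sym H v u) uv

  cycle : ∀ {m} (vs : Vec (Fin n) (suc m)) → 3 ≤ suc m → Unique vs →
          (∀ i → adj H (lookup vs (inject₁ i)) (lookup vs (fsuc i)) ≡ true) →
          adj H (lookup vs (fromℕ m)) (lookup vs fzero) ≡ true → Cycle H (suc m)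
  cycle {m} vs 3≤len unique steps closing = record
    { m = m ; len≡ = refl ; len≥3 = 3≤len ; walk = lookup vs
    ; inj = lookup-injective unique ; step = steps ; close = closing }

  module _ (girth≥5 : GirthAtLeast 5 H) where

    girth≥5⇒triangleFree : TriangleFree H
    girth≥5⇒triangleFree a b c ab bc ca = <⇒≱ (n≤1+n 4) (girth≥5 3 triangle)
      where
      triangle : Cycle H 3
      triangle = cycle (a ∷ b ∷ c ∷ []) ≤-refl
        ((adj⇒≢ ab ∷ adj⇒≢ ca ∘ sym ∷ []) ∷ (adj⇒≢ bc ∷ []) ∷ [] ∷ [])
        (λ { fzero → ab ; (fsuc fzero) → bc }) ca

    girth≥5⇒squareFree : SquareFree H
    girth≥5⇒squareFree a b c d a≢c b≢d ab bc cd da = <⇒≱ ≤-refl (girth≥5 4 square)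
      where
      square : Cycle H 4
      square = cycle (a ∷ b ∷ c ∷ d ∷ []) (n≤1+n 3)
        ((adj⇒≢ ab ∷ a≢c ∷ adj⇒≢ da ∘ sym ∷ []) ∷ (adj⇒≢ bc ∷ b≢d ∷ []) ∷ (adj⇒≢ cd ∷ []) ∷ [] ∷ [])
        (λ { fzero → ab ; (fsuc fzero) → bc ; (fsuc (fsuc fzero)) → cd }) da

  2≤degree⇒other-neighbour : ∀ {v x} → 2 ≤ count (adj H x) → ∃ λ w → w ≢ v × adj H x w ≡ true
  2≤degree⇒other-neighbour {v} {x} deg with 2≤count⇒∃₂ (adj H x) deg
  ... | y , z , y≢z , xy , xz with y Fin.≟ v
  ...   | yes refl = z , y≢z ∘ sym , xz
  ...   | no y≢v   = y , y≢v , xy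

  universal⇒¬triangleFree : TriangleFree H → (∀ u → 2 ≤ count (adj H u)) →
                            ∀ v → (∀ u → u ≢ v → adj H v u ≡ true) → ⊥
  universal⇒¬triangleFree triangleFree deg v universal =
    let x , vx = 1≤count⇒∃ (adj H v) (≤-trans (n≤1+n 1) (deg v))
        w , w≢v , xw = 2≤degree⇒other-neighbour (deg x)
    in triangleFree v x w vx xw (adj-sym (universal w w≢v))

regular₁⇒perfectMatching : ∀ {n} (H : Graph n) → Regular 1 H → PerfectMatching H
regular₁⇒perfectMatching H regular = record
  { M = adj H ; M-sym = Graph.sym H ; M⊆E = λ _ _ uv → uv ; cover1 = regular }

module _ {n : ℕ} (G : Graph n) where

  adjᶜ-intro : ∀ {u v} → u ≢ v → adj G u v ≡ false → adj (complement G) u v ≡ true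
  adjᶜ-intro {u} {v} u≢v uv with u Fin.≟ v
  ... | yes u≡v = ⊥-elim (u≢v u≡v)
  ... | no _ rewrite uv = refl

  adjᶜ-elim : ∀ {u v} → adj (complement G) u v ≡ true → adj G u v ≡ false
  adjᶜ-elim {u} {v} uv with u Fin.≟ v
  adjᶜ-elim () | yes _
  ... | no _ with adj G u v
  ...   | false = refl
  adjᶜ-elim () | no _ | true

-- Separations in dimensions

HasTwoPartners : ∀ {n ℓ} → (Fin n → Fin n → Set ℓ) → Fin n → Set ℓ
HasTwoPartners _~_ v = ∃₂ λ x y → x ≢ y × v ~ x × v ~ y

module Separations
  {n D : ℕ} (H : Graph n) (triangleFree : TriangleFree H) (local : Fin n → Fin D → Bool)
  {ℓ} (Sep : Fin D → Fin n → Fin n → Set ℓ) (Sep? : ∀ i u v → Dec (Sep i u v))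
  (Sep-sym : ∀ {i u v} → Sep i u v → Sep i v u)
  (Sep⇒local : ∀ {i u v} → Sep i u v → local u i ≡ true)
  (Sep⇒adj : ∀ {i u v} → Sep i u v → adj H u v ≡ true)
  (adj⇒Sep : ∀ {u v} → adj H u v ≡ true → ¬ (∀ i → ¬ Sep i u v))
  (twoPartners⇒Sep : ∀ {i v w} → v ≢ w → HasTwoPartners (Sep i) v → HasTwoPartners (Sep i) w →
                     ¬ ¬ Sep i v w)
  where

  sep : Fin D → Fin n → Fin n → Bool
  sep i u v = does (Sep? i u v)

  sep⇒Sep : ∀ {i u v} → sep i u v ≡ true → Sep i u v
  sep⇒Sep {i} {u} {v} _ with Sep? i u v
  ... | yes s = s

  Sep⇒sep : ∀ {i u v} → Sep i u v → sep i u v ≡ true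
  Sep⇒sep {i} {u} {v} = dec-true (Sep? i u v)

  adj⇒∃Sep : ∀ {u v} → adj H u v ≡ true → ∃ λ i → Sep i u v
  adj⇒∃Sep {u} {v} uv with Fin.any? (λ i → Sep? i u v)
  ... | yes separated = separated
  ... | no ¬separated = ⊥-elim (adj⇒Sep uv λ i s → ¬separated (i , s))

  sep-outside-local : ∀ {i v} → local v i ≡ false → ∀ u → sep i v u ≡ false
  sep-outside-local {i} {v} v∉i u with sep i v u in s
  ... | false = refl
  ... | true with () ← trans (sym (Sep⇒local (sep⇒Sep s))) v∉i

  heavy : Fin D → Fin n → Bool
  heavy i v = 1 <ᵇ count (sep i v)

  heavy⇒2≤count : ∀ {i v} → heavy i v ≡ true → 2 ≤ count (sep i v)
  heavy⇒2≤count {i} {v} h = <ᵇ⇒< 1 (count (sep i v)) (subst T (sym h) tt)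

  light⇒count≤1 : ∀ {i v} → heavy i v ≡ false → count (sep i v) ≤ 1
  light⇒count≤1 {i} {v} h = ≮⇒≥ λ 1<count → subst T h (<⇒<ᵇ 1<count)

  heavy⇒twoPartners : ∀ {i v} → heavy i v ≡ true → HasTwoPartners (Sep i) v
  heavy⇒twoPartners {i} {v} h =
    let x , y , x≢y , vx , vy = 2≤count⇒∃₂ (sep i v) (heavy⇒2≤count h)
    in x , y , x≢y , sep⇒Sep vx , sep⇒Sep vy

  heavy-sep : ∀ {i v w} → heavy i v ≡ true → heavy i w ≡ true → v ≢ w → sep i v w ≡ true
  heavy-sep {i} {v} {w} hv hw v≢w = Sep⇒sep (decidable-stable (Sep? i v w)
    (twoPartners⇒Sep v≢w (heavy⇒twoPartners hv) (heavy⇒twoPartners hw)))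

  heavyDims : Fin n → ℕ
  heavyDims v = count (λ i → heavy i v)

  lightNbr : Fin n → Fin n → Bool
  lightNbr v u = any λ i → not (heavy i v) ∧ sep i v u

  heavyNbr : Fin n → Fin n → Bool
  heavyNbr v u = adj H v u ∧ not (lightNbr v u)

  mutualHeavyNbr : Fin n → Fin n → Bool
  mutualHeavyNbr v u = heavyNbr v u ∧ heavyNbr u v

  heavyNbr⇒adj : ∀ {v u} → heavyNbr v u ≡ true → adj H v u ≡ true
  heavyNbr⇒adj = ∧-conicalˡ _ _

  heavyNbr-sep⇒heavy : ∀ {i v u} → heavyNbr v u ≡ true → sep i v u ≡ true → heavy i v ≡ true
  heavyNbr-sep⇒heavy {i} {v} {u} vu vu∈i =
    not-light (heavy i v) (¬any⇒∀ (not-injective (∧-conicalʳ _ _ vu)) i) vu∈i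
    where
    not-light : ∀ h {s} → not h ∧ s ≡ false → s ≡ true → h ≡ true
    not-light true  _     _  = refl
    not-light false refl ()

  dimension-load : ∀ i v → indicator (heavy i v) + count (λ u → not (heavy i v) ∧ sep i v u)
                           ≤ indicator (local v i)
  dimension-load i v with local v i in v∈i
  ... | false = ≤-reflexive (cong₂ _+_ (cong (indicator ∘ (1 <ᵇ_)) none)
                                       (none⇒count≡0 _ λ u → trans (cong (not (heavy i v) ∧_) (empty u)) (∧-zeroʳ _)))
    where
    empty : ∀ u → sep i v u ≡ false
    empty = sep-outside-local v∈i
    none : count (sep i v) ≡ 0
    none = none⇒count≡0 (sep i v) empty
  ... | true with heavy i v in h
  ...   | true  = ≤-reflexive (cong suc (none⇒count≡0 {n} (λ _ → false) λ _ → refl))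
  ...   | false = light⇒count≤1 h

  heavyDims+lightNbrs≤localDims : ∀ v → heavyDims v + count (lightNbr v) ≤ count (local v)
  heavyDims+lightNbrs≤localDims v = begin
    heavyDims v + count (lightNbr v)
      ≤⟨ +-monoʳ-≤ (heavyDims v) (cover⇒count≤∑count (lightNbr v) lightSep (λ _ → any⇒∃)) ⟩
    heavyDims v + sum (λ i → count (lightSep i))
      ≡⟨ ∑-distrib-+ (λ i → indicator (heavy i v)) (count ∘ lightSep) ⟨
    sum (λ i → indicator (heavy i v) + count (lightSep i))
      ≤⟨ sum-mono-≤ (λ i → dimension-load i v) ⟩
    count (local v) ∎
    where
    open ≤-Reasoning
    lightSep : Fin D → Fin n → Bool
    lightSep i u = not (heavy i v) ∧ sep i v u

  mutual⇒heavyDim : ∀ {v u} → mutualHeavyNbr v u ≡ true → ∃ λ i → heavy i v ∧ (sep i v u ∧ heavy i u) ≡ true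
  mutual⇒heavyDim {v} {u} m =
    let vu = ∧-conicalˡ (heavyNbr v u) _ m
        uv = ∧-conicalʳ (heavyNbr v u) _ m
        i , s = adj⇒∃Sep (heavyNbr⇒adj vu)
    in i , ∧-intro (heavyNbr-sep⇒heavy vu (Sep⇒sep s))
                   (∧-intro (Sep⇒sep s) (heavyNbr-sep⇒heavy uv (Sep⇒sep (Sep-sym s))))

  heavy-partner-unique : ∀ i v → count (λ u → heavy i v ∧ (sep i v u ∧ heavy i u)) ≤ indicator (heavy i v)
  heavy-partner-unique i v with heavy i v in hv
  ... | false = ≤-reflexive (none⇒count≡0 {n} (λ _ → false) λ _ → refl)
  ... | true  = unique⇒count≤1 (λ u → sep i v u ∧ heavy i u) unique
    where
    unique : ∀ x y → sep i v x ∧ heavy i x ≡ true → sep i v y ∧ heavy i y ≡ true → x ≡ y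
    unique x y vx vy with x Fin.≟ y
    ... | yes x≡y = x≡y
    ... | no  x≢y = ⊥-elim (triangleFree v x y
      (Sep⇒adj (sep⇒Sep (∧-conicalˡ _ _ vx)))
      (Sep⇒adj (sep⇒Sep (heavy-sep (∧-conicalʳ _ _ vx) (∧-conicalʳ _ _ vy) x≢y)))
      (adj-sym H (Sep⇒adj (sep⇒Sep (∧-conicalˡ _ _ vy)))))

  mutual≤heavyDims : ∀ v → count (mutualHeavyNbr v) ≤ heavyDims v
  mutual≤heavyDims v = ≤-trans
    (cover⇒count≤∑count (mutualHeavyNbr v) (λ i u → heavy i v ∧ (sep i v u ∧ heavy i u)) (λ _ → mutual⇒heavyDim))
    (sum-mono-≤ λ i → heavy-partner-unique i v)

  heavyNbr⇒heavyDim : ∀ {v u} → heavyNbr v u ≡ true → 1 ≤ heavyDims v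
  heavyNbr⇒heavyDim {v} vu =
    let i , s = adj⇒∃Sep (heavyNbr⇒adj vu) in witness⇒1≤count (λ i → heavy i v) (heavyNbr-sep⇒heavy vu (Sep⇒sep s))

  heavyNbr-pairs : sum (λ v → count (heavyNbr v) + count (heavyNbr v)) ≤
                   sum (λ v → count (adj H v) + count (mutualHeavyNbr v))
  heavyNbr-pairs = begin
    sum (λ v → count (heavyNbr v) + count (heavyNbr v))
      ≡⟨ ∑-+-transpose (λ v u → indicator (heavyNbr v u)) ⟩
    sum (λ v → sum (λ u → indicator (heavyNbr v u) + indicator (heavyNbr u v)))
      ≤⟨ sum-mono-≤ (λ v → sum-mono-≤ (pair v)) ⟩
    sum (λ v → sum (λ u → indicator (adj H v u) + indicator (mutualHeavyNbr v u)))
      ≡⟨ sum-cong-≗ (λ v → ∑-distrib-+ (indicator ∘ adj H v) (indicator ∘ mutualHeavyNbr v)) ⟩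
    sum (λ v → count (adj H v) + count (mutualHeavyNbr v)) ∎
    where
    open ≤-Reasoning
    pair : ∀ v u → indicator (heavyNbr v u) + indicator (heavyNbr u v) ≤
                   indicator (adj H v u) + indicator (mutualHeavyNbr v u)
    pair v u rewrite Graph.sym H u v = indicator-∧-pair (adj H v u) _ _

  perfectMatching : ∀ j → 1 ≤ j → (∀ v → count (adj H v) ≡ suc (j + j)) →
                    (∀ v → count (local v) ≤ suc j) → PerfectMatching H
  perfectMatching j 1≤j regular localDims≤ = record
    { M      = mutualHeavyNbr
    ; M-sym  = λ u v → ∧-comm (heavyNbr u v) (heavyNbr v u)
    ; M⊆E    = λ u v → heavyNbr⇒adj ∘ ∧-conicalˡ (heavyNbr u v) _
    ; cover1 = λ v → trans (countTrue≡count (mutualHeavyNbr v))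
                           (odd+m≡double⇒m≡1 j (heavyDims v) _ (mutual≤heavyDims v) (squeezed v))
    }
    where
    lower : ∀ v → j + heavyDims v ≤ count (heavyNbr v)
    lower v = odd≤l+h⇒j+a≤h j (heavyDims v) (count (lightNbr v)) (count (heavyNbr v))
      (subst (_≤ count (lightNbr v) + count (heavyNbr v)) (regular v) (count-≤-split (adj H v) (lightNbr v)))
      (≤-trans (heavyDims+lightNbrs≤localDims v) (localDims≤ v))

    1≤heavyDims : ∀ v → 1 ≤ heavyDims v
    1≤heavyDims v = heavyNbr⇒heavyDim (proj₂ (1≤count⇒∃ (heavyNbr v)
      (≤-trans 1≤j (≤-trans (m≤m+n j _) (lower v)))))

    squeezed : ∀ v → (j + heavyDims v) + (j + heavyDims v) ≡ suc (j + j) + count (mutualHeavyNbr v)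
    squeezed = sum-squeeze
      (λ v → odd+m≤double j (heavyDims v) _ (mutual≤heavyDims v) (1≤heavyDims v))
      (begin
        sum (λ v → (j + heavyDims v) + (j + heavyDims v))
          ≤⟨ sum-mono-≤ (λ v → +-mono-≤ (lower v) (lower v)) ⟩
        sum (λ v → count (heavyNbr v) + count (heavyNbr v))
          ≤⟨ heavyNbr-pairs ⟩
        sum (λ v → count (adj H v) + count (mutualHeavyNbr v))
          ≡⟨ sum-cong-≗ (λ v → cong (_+ count (mutualHeavyNbr v)) (regular v)) ⟩
        sum (λ v → suc (j + j) + count (mutualHeavyNbr v)) ∎)
      where open ≤-Reasoning

-- Intervals and interval orders

module Intervals (R : Reals) where
  open Reals R
  open IsStrictTotalOrder isStrictTotalOrder
    using (compare) renaming (_<?_ to _<ℝ?_; trans to <ℝ-trans; irrefl to <ℝ-irrefl; asym to <ℝ-asym)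

  _∈_ : ℝ → Interval R → Set
  x ∈ I = _∈I_ R x I

  NonEmpty : Interval R → Set
  NonEmpty I = ∃ λ x → x ∈ I

  Disjoint : Interval R → Interval R → Set
  Disjoint I J = ¬ ∃ λ x → x ∈ I × x ∈ J

  _≺_ : Interval R → Interval R → Set
  I ≺ J = ∀ {x y} → x ∈ I → y ∈ J → x <ℝ y

  ≤ℝ-<ℝ-trans : ∀ {x y z} → ¬ y <ℝ x → y <ℝ z → x <ℝ z
  ≤ℝ-<ℝ-trans {x} {y} {z} x≤y y<z with compare x z
  ... | tri< x<z _ _ = x<z
  ... | tri≈ _ refl _ = ⊥-elim (x≤y y<z)
  ... | tri> _ _ z<x = ⊥-elim (x≤y (<ℝ-trans y<z z<x))

  <ℝ-≤ℝ-trans : ∀ {x y z} → x <ℝ y → ¬ z <ℝ y → x <ℝ z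
  <ℝ-≤ℝ-trans {x} {y} {z} x<y y≤z with compare x z
  ... | tri< x<z _ _ = x<z
  ... | tri≈ _ refl _ = ⊥-elim (y≤z x<y)
  ... | tri> _ _ z<x = ⊥-elim (y≤z (<ℝ-trans z<x x<y))

  ∈-convex : ∀ I {x y z} → x ∈ I → z ∈ I → ¬ y <ℝ x → ¬ z <ℝ y → y ∈ I
  ∈-convex (bounded a ca b cb) (a≤x , x≤b) (a≤z , z≤b) x≤y y≤z = lower ca a≤x , upper cb z≤b
    where
    lower : ∀ c → lowerOK R c a _ → lowerOK R c a _
    lower true  a≤x y<a = a≤x (≤ℝ-<ℝ-trans x≤y y<a)
    lower false a<x     = <ℝ-≤ℝ-trans a<x x≤y
    upper : ∀ c → upperOK R c b _ → upperOK R c b _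
    upper true  z≤b b<y = z≤b (<ℝ-≤ℝ-trans b<y y≤z)
    upper false z<b     = ≤ℝ-<ℝ-trans y≤z z<b
  ∈-convex whole _ _ _ _ = tt

  ≺⇒disjoint : ∀ {I J} → I ≺ J → Disjoint I J
  ≺⇒disjoint I≺J (x , x∈I , x∈J) = <ℝ-irrefl refl (I≺J x∈I x∈J)

  disjoint-sym : ∀ {I J} → Disjoint I J → Disjoint J I
  disjoint-sym disjoint (x , x∈J , x∈I) = disjoint (x , x∈I , x∈J)

  disjoint-ordered : ∀ I J {p q} → Disjoint I J → p ∈ I → q ∈ J → p <ℝ q → I ≺ J
  disjoint-ordered I J {p} disjoint p∈I q∈J p<q {x} {y} x∈I y∈J =
    decidable-stable (x <ℝ? y) λ x≮y → disjoint (meet x≮y)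
    where
    meet : ¬ x <ℝ y → ∃ λ z → z ∈ I × z ∈ J
    meet y≤x with y <ℝ? p
    ... | yes y<p = p , p∈I , ∈-convex J y∈J q∈J (<ℝ-asym y<p) (<ℝ-asym p<q)
    ... | no p≤y  = y , ∈-convex I p∈I x∈I p≤y y≤x , y∈J

  disjoint⇒≺⊎≻ : ∀ {I J} → Disjoint I J → NonEmpty I → NonEmpty J → I ≺ J ⊎ J ≺ I
  disjoint⇒≺⊎≻ {I} {J} disjoint (p , p∈I) (q , q∈J) with compare p q
  ... | tri< p<q _ _ = inj₁ (disjoint-ordered I J disjoint p∈I q∈J p<q)
  ... | tri≈ _ refl _ = ⊥-elim (disjoint (p , p∈I , q∈J))
  ... | tri> _ _ q<p = inj₂ (disjoint-ordered J I (disjoint-sym disjoint) q∈J p∈I q<p)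

  ≺-2+2 : ∀ {I J K L} → I ≺ J → K ≺ L → ¬ K ≺ J → I ≺ L
  ≺-2+2 I≺J K≺L K⊀J {x} {y} x∈I y∈L =
    decidable-stable (x <ℝ? y) λ x≮y → K⊀J λ z∈K w∈J → <ℝ-trans (<ℝ-≤ℝ-trans (K≺L z∈K y∈L) x≮y) (I≺J x∈I w∈J)

  disjoint⇒bounded : ∀ {I J} → Disjoint I J → NonEmpty J → isBounded R I ≡ true
  disjoint⇒bounded {bounded _ _ _ _} _ _ = refl
  disjoint⇒bounded {whole} disjoint (q , q∈J) = ⊥-elim (disjoint (q , tt , q∈J))

-- ≺-2+2 is the condition characterising interval orders.
module _ {n : ℕ} (H : Graph n) {ℓ} (_≺_ : Fin n → Fin n → Set ℓ)
         (≺⇒adj : ∀ {a b} → a ≺ b → adj H a b ≡ true)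
         (≺-2+2 : ∀ {a b c d} → a ≺ b → c ≺ d → ¬ c ≺ b → a ≺ d) where

  ≺-trans : ∀ {a b c} → a ≺ b → b ≺ c → a ≺ c
  ≺-trans a≺b b≺c = ≺-2+2 a≺b b≺c λ b≺b → adj⇒≢ H (≺⇒adj b≺b) refl

  ≺-chain⇒¬triangleFree : ∀ {a b c} → a ≺ b → b ≺ c → ¬ TriangleFree H
  ≺-chain⇒¬triangleFree {a} {b} {c} a≺b b≺c triangleFree =
    triangleFree a b c (≺⇒adj a≺b) (≺⇒adj b≺c) (adj-sym H (≺⇒adj (≺-trans a≺b b≺c)))

  two-common-upper-bounds⇒¬squareFree : ∀ {a b c d} → a ≺ b → c ≺ b → c ≺ d → a ≺ d →
                                         a ≢ c → b ≢ d → ¬ SquareFree H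
  two-common-upper-bounds⇒¬squareFree {a} {b} {c} {d} a≺b c≺b c≺d a≺d a≢c b≢d squareFree =
    squareFree a b c d a≢c b≢d (≺⇒adj a≺b) (adj-sym H (≺⇒adj c≺b)) (≺⇒adj c≺d) (adj-sym H (≺⇒adj a≺d))

  module _ (squareFree : SquareFree H) where

    two-below-both : ∀ {x y v p q w} → x ≺ v → y ≺ v → p ≺ w → q ≺ w →
                     x ≢ y → p ≢ q → v ≢ w → ⊥
    two-below-both {x} {y} {v} {p} {q} {w} x≺v y≺v p≺w q≺w x≢y p≢q v≢w =
      ¬¬-excluded-middle λ where
        (no x⊀w)  → below-v-only x≺v x⊀w
        (yes x≺w) → ¬¬-excluded-middle λ where
          (no y⊀w)  → below-v-only y≺v y⊀w
          (yes y≺w) → two-common-upper-bounds⇒¬squareFree x≺v y≺v y≺w x≺w x≢y v≢w squareFree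
      where
      below-v-only : ∀ {a} → a ≺ v → ¬ a ≺ w → ⊥
      below-v-only a≺v a⊀w = two-common-upper-bounds⇒¬squareFree
        (≺-2+2 p≺w a≺v a⊀w) (≺-2+2 q≺w a≺v a⊀w) q≺w p≺w p≢q v≢w squareFree

    two-below-two-above : ∀ {x y v p q w} → x ≺ v → y ≺ v → w ≺ p → w ≺ q → ¬ w ≺ v →
                          x ≢ y → p ≢ q → ⊥
    two-below-two-above x≺v y≺v w≺p w≺q w⊀v x≢y p≢q = two-common-upper-bounds⇒¬squareFree
      (≺-2+2 x≺v w≺p w⊀v) (≺-2+2 y≺v w≺p w⊀v) (≺-2+2 y≺v w≺q w⊀v) (≺-2+2 x≺v w≺q w⊀v) x≢y p≢q squareFree

Comparable : ∀ {n ℓ} → (Fin n → Fin n → Set ℓ) → Fin n → Fin n → Set ℓ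
Comparable _≺_ a b = a ≺ b ⊎ b ≺ a

module _ {n : ℕ} {H : Graph n} (triangleFree : TriangleFree H) (squareFree : SquareFree H)
         {ℓ} {_≺_ : Fin n → Fin n → Set ℓ}
         (≺⇒adj : ∀ {a b} → a ≺ b → adj H a b ≡ true)
         (≺-2+2 : ∀ {a b c d} → a ≺ b → c ≺ d → ¬ c ≺ b → a ≺ d) where

  private
    ≻⇒adj : ∀ {a b} → b ≺ a → adj H a b ≡ true
    ≻⇒adj = adj-sym H ∘ ≺⇒adj

    ≻-2+2 : ∀ {a b c d} → b ≺ a → d ≺ c → ¬ b ≺ c → d ≺ a
    ≻-2+2 b≺a d≺c b⊀c = ≺-2+2 d≺c b≺a b⊀c

    both-below-or-both-above : ∀ {v x y} → Comparable _≺_ v x → Comparable _≺_ v y →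
                               (x ≺ v × y ≺ v) ⊎ (v ≺ x × v ≺ y)
    both-below-or-both-above (inj₁ v≺x) (inj₁ v≺y) = inj₂ (v≺x , v≺y)
    both-below-or-both-above (inj₂ x≺v) (inj₂ y≺v) = inj₁ (x≺v , y≺v)
    both-below-or-both-above (inj₁ v≺x) (inj₂ y≺v) =
      ⊥-elim (≺-chain⇒¬triangleFree H _≺_ ≺⇒adj ≺-2+2 y≺v v≺x triangleFree)
    both-below-or-both-above (inj₂ x≺v) (inj₁ v≺y) =
      ⊥-elim (≺-chain⇒¬triangleFree H _≺_ ≺⇒adj ≺-2+2 x≺v v≺y triangleFree)

  twoPartners⇒comparable : ∀ {v w} → v ≢ w → HasTwoPartners (Comparable _≺_) v →
                           HasTwoPartners (Comparable _≺_) w → ¬ ¬ Comparable _≺_ v w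
  twoPartners⇒comparable v≢w (x , y , x≢y , vx , vy) (p , q , p≢q , wp , wq) incomparable
    with both-below-or-both-above vx vy | both-below-or-both-above wp wq
  ... | inj₁ (x≺v , y≺v) | inj₁ (p≺w , q≺w) =
    two-below-both H _≺_ ≺⇒adj ≺-2+2 squareFree x≺v y≺v p≺w q≺w x≢y p≢q v≢w
  ... | inj₂ (v≺x , v≺y) | inj₂ (w≺p , w≺q) =
    two-below-both H (flip _≺_) ≻⇒adj ≻-2+2 squareFree v≺x v≺y w≺p w≺q x≢y p≢q v≢w
  ... | inj₁ (x≺v , y≺v) | inj₂ (w≺p , w≺q) =
    two-below-two-above H _≺_ ≺⇒adj ≺-2+2 squareFree x≺v y≺v w≺p w≺q (incomparable ∘ inj₂) x≢y p≢q
  ... | inj₂ (v≺x , v≺y) | inj₁ (p≺w , q≺w) =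
    two-below-two-above H _≺_ ≺⇒adj ≺-2+2 squareFree p≺w q≺w v≺x v≺y (incomparable ∘ inj₁) p≢q x≢y

-- Box representations

¬¬-Π-Fin : ∀ {n p} {P : Fin n → Set p} → (∀ i → ¬ ¬ P i) → ¬ ¬ (∀ i → P i)
¬¬-Π-Fin {zero}  ¬¬P ¬∀P = ¬∀P λ ()
¬¬-Π-Fin {suc n} ¬¬P ¬∀P = ¬¬P fzero λ P0 → ¬¬-Π-Fin (¬¬P ∘ fsuc) λ P+ → ¬∀P λ where
  fzero    → P0
  (fsuc i) → P+ i

Represents : ∀ (R : Reals) {n D} → (Fin n → Box R D) → Graph n → Set
Represents R B G = ∀ u v → u ≢ v → (adj G u v ≡ true → BoxesMeet R (B u) (B v))
                                   × (BoxesMeet R (B u) (B v) → adj G u v ≡ true)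

module BoxRepresentation (R : Reals) {n : ℕ} (G : Graph n) {D : ℕ} (B : Fin n → Box R D)
                         (represents : Represents R B G) where
  open Intervals R

  disjoint⇒¬adj : ∀ {u v} i → Disjoint (B u i) (B v i) → adj G u v ≡ false
  disjoint⇒¬adj {u} {v} i disjoint with u Fin.≟ v
  ... | yes refl = irrefl G u
  ... | no u≢v with adj G u v in uv
  ...   | false = refl
  ...   | true  = let p , p∈ = proj₁ (represents u v u≢v) uv in ⊥-elim (disjoint (p i , p∈ i))

  empty⇒universal : ∀ {v i} → ¬ NonEmpty (B v i) → ∀ u → u ≢ v → adj (complement G) v u ≡ true
  empty⇒universal {i = i} empty u u≢v =
    adjᶜ-intro G (u≢v ∘ sym) (disjoint⇒¬adj i λ (x , x∈v , _) → empty (x , x∈v))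

  module _ (nonEmpty : ∀ v i → NonEmpty (B v i)) where

    _≺⟨_⟩_ : Fin n → Fin D → Fin n → Set
    u ≺⟨ i ⟩ v = B u i ≺ B v i

    ≺⇒adjᶜ : ∀ {i u v} → u ≺⟨ i ⟩ v → adj (complement G) u v ≡ true
    ≺⇒adjᶜ {i} {u} {v} u≺v = adjᶜ-intro G u≢v (disjoint⇒¬adj i (≺⇒disjoint u≺v))
      where
      u≢v : u ≢ v
      u≢v refl = ≺⇒disjoint u≺v (proj₁ (nonEmpty u i) , proj₂ (nonEmpty u i) , proj₂ (nonEmpty u i))

    adjᶜ⇒comparable : ∀ {u v} → adj (complement G) u v ≡ true → ¬ (∀ i → ¬ Comparable _≺⟨ i ⟩_ u v)
    adjᶜ⇒comparable {u} {v} uv incomparable =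
      ¬¬-Π-Fin overlapping λ meet →
        true≢false (trans (sym (proj₂ (represents u v (adj⇒≢ (complement G) uv)) (meetingPoint meet)))
                          (adjᶜ-elim G uv))
      where
      overlapping : ∀ i → ¬ ¬ ∃ λ x → x ∈ B u i × x ∈ B v i
      overlapping i disjoint = incomparable i (disjoint⇒≺⊎≻ disjoint (nonEmpty u i) (nonEmpty v i))
      meetingPoint : (∀ i → ∃ λ x → x ∈ B u i × x ∈ B v i) → BoxesMeet R (B u) (B v)
      meetingPoint meet = (λ i → proj₁ (meet i)) , (λ i → proj₂ (meet i))

    comparable⇒bounded : ∀ {i u v} → Comparable _≺⟨ i ⟩_ u v → isBounded R (B u i) ≡ true
    comparable⇒bounded {i} {v = v} (inj₁ u≺v) = disjoint⇒bounded (≺⇒disjoint u≺v) (nonEmpty v i)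
    comparable⇒bounded {i} {v = v} (inj₂ v≺u) = disjoint⇒bounded (disjoint-sym (≺⇒disjoint v≺u)) (nonEmpty v i)

    comparable⇒adjᶜ : ∀ {i u v} → Comparable _≺⟨ i ⟩_ u v → adj (complement G) u v ≡ true
    comparable⇒adjᶜ (inj₁ u≺v) = ≺⇒adjᶜ u≺v
    comparable⇒adjᶜ {u = u} {v} (inj₂ v≺u) = adj-sym (complement G) {v} {u} (≺⇒adjᶜ v≺u)

    perfectMatching : TriangleFree (complement G) → SquareFree (complement G) →
                      (∀ i u v → Dec (Comparable _≺⟨ i ⟩_ u v)) →
                      ∀ j → 1 ≤ j → (∀ v → count (adj (complement G) v) ≡ suc (j + j)) →
                      (∀ v → localDims R (B v) ≤ suc j) → PerfectMatching (complement G)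
    perfectMatching triangleFree squareFree comparable? j 1≤j regular localDims≤ =
      Separations.perfectMatching (complement G) triangleFree (λ v i → isBounded R (B v i))
        (λ i → Comparable _≺⟨ i ⟩_) comparable? swap comparable⇒bounded comparable⇒adjᶜ adjᶜ⇒comparable
        (λ {i} → twoPartners⇒comparable {H = complement G} triangleFree squareFree {_≺_ = _≺⟨ i ⟩_}
                   (λ {a b} → ≺⇒adjᶜ {i} {a} {b}) λ {a b c d} → ≺-2+2 {B a i} {B b i} {B c i} {B d i})
        j 1≤j regular (λ v → subst (_≤ suc j) (countTrue≡count (λ i → isBounded R (B v i))) (localDims≤ v))

  ¬¬perfectMatching : ∀ j → Regular (suc (j + j)) (complement G) → GirthAtLeast 5 (complement G) →
                      (∀ v → localDims R (B v) ≤ suc j) → ¬ ¬ PerfectMatching (complement G)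
  ¬¬perfectMatching zero    regular _     _           ¬pm = ¬pm (regular₁⇒perfectMatching (complement G) regular)
  ¬¬perfectMatching (suc j) regular girth localDims≤ ¬pm =
    ¬¬-excluded-middle {A = ∃₂ λ v i → ¬ NonEmpty (B v i)} λ where
      (yes (v , i , empty)) → universal⇒¬triangleFree Hᶜ triangleFree degree≥2 v (empty⇒universal empty)
      (no ¬empty) →
        ¬¬-Π-Fin (λ v → ¬¬-Π-Fin λ i ¬nonEmpty → ¬empty (v , i , ¬nonEmpty)) λ nonEmpty →
        ¬¬-Π-Fin (λ i → ¬¬-Π-Fin λ u → ¬¬-Π-Fin λ v → ¬¬-excluded-middle) λ comparable? →
        ¬pm (perfectMatching nonEmpty triangleFree (girth≥5⇒squareFree Hᶜ girth) comparable?
                             (suc j) (s≤s z≤n) regular′ localDims≤)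
    where
    Hᶜ : Graph n
    Hᶜ = complement G
    triangleFree : TriangleFree Hᶜ
    triangleFree = girth≥5⇒triangleFree Hᶜ girth
    regular′ : ∀ v → count (adj Hᶜ v) ≡ suc (suc j + suc j)
    regular′ v = trans (sym (countTrue≡count (adj Hᶜ v))) (regular v)
    degree≥2 : ∀ u → 2 ≤ count (adj Hᶜ u)
    degree≥2 u = subst (2 ≤_) (sym (regular′ u)) (s≤s (s≤s z≤n))

¬odd+3≤2d⇒d≤j+1 : ∀ j d → ¬ suc (2 * j) + 3 ≤ 2 * d → d ≤ suc j
¬odd+3≤2d⇒d≤j+1 j d k+3≰2d =
  ≤-pred (*-cancelˡ-< 2 d (suc (suc j)) (subst (2 * d <_) (odd+3 j) (≰⇒> k+3≰2d)))
  where
  odd+3 : ∀ j → suc (2 * j) + 3 ≡ 2 * suc (suc j)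
  odd+3 = solve-∀

lemma6p2 : (R : Reals) → (n : ℕ) → (G : Graph n) → (k : ℕ) →
    (∃ λ j → k ≡ suc (2 * j)) →
    Regular k (complement G) →
    GirthAtLeast 5 (complement G) →
    ¬ PerfectMatching (complement G) →
    LboxAtLeastHalf R G (k + 3)
lemma6p2 R n G _ (j , refl) regular girth noPerfectMatching d (_ , _ , B , localDims≤d , represents) =
  decidable-stable (suc (2 * j) + 3 ≤? 2 * d) λ k+3≰2d →
    ¬¬perfectMatching j (subst (λ m → Regular (suc m) (complement G)) (cong (j +_) (+-identityʳ j)) regular)
      girth (λ v → ≤-trans (localDims≤d v) (¬odd+3≤2d⇒d≤j+1 j d k+3≰2d)) noPerfectMatching
  where open BoxRepresentation R G B represents
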